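{- For each of the following 32 triplets, the minimal term $b_n=\min_{|v|=n}\min_i b_i(v)$ of level $n$ of the TRIP-Stern tree equals $1$ for every $n\ge0$: $(e,12,12)$, $(e,12,123)$, $(e,12,132)$, $(e,13,123)$, $(e,13,132)$, $(e,23,12)$, $(e,23,123)$, $(e,23,132)$, $(e,123,12)$, $(e,123,123)$, $(e,123,132)$, $(e,e,e)$, $(e,e,12)$, $(e,e,13)$, $(e,e,23)$, $(e,13,e)$, $(e,13,13)$, $(e,13,23)$, $(e,132,e)$, $(e,132,12)$, $(e,132,13)$, $(e,132,23)$, $(e,12,e)$, $(e,12,13)$, $(e,12,23)$, $(e,13,12)$, $(e,23,e)$, $(e,23,13)$, $(e,23,23)$, $(e,123,e)$, $(e,123,13)$, $(e,123,23)$.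
   Context: Let $A_0=\begin{pmatrix}0&0&1\\1&0&0\\0&1&1\end{pmatrix}$, $A_1=\begin{pmatrix}1&0&1\\0&1&0\\0&0&1\end{pmatrix}$. Elements of $S_3$ are identified with permutation matrices: $e=I$, $(12)=\begin{pmatrix}0&1&0\\1&0&0\\0&0&1\end{pmatrix}$, $(13)=\begin{pmatrix}0&0&1\\0&1&0\\1&0&0\end{pmatrix}$, $(23)=\begin{pmatrix}1&0&0\\0&0&1\\0&1&0\end{pmatrix}$, $(123)=\begin{pmatrix}0&1&0\\0&0&1\\1&0&0\end{pmatrix}$, $(132)=\begin{pmatrix}0&0&1\\1&0&0\\0&1&0\end{pmatrix}$. For $(\sigma,\tau_0,\tau_1)\in S_3^3$ put $F_0=\sigma A_0\tau_0$, $F_1=\sigma A_1\tau_1$. For $v=(i_1,\dots,i_n)\in\{0,1\}^n$ let $\triangle(v)=(1,1,1)F_{i_1}\cdots F_{i_n}=(b_1(v),b_2(v),b_3(v))$; level $n$ of the TRIP-Stern tree consists of the $\triangle(v)$ with $|v|=n$. -}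

module Defs where

open import Data.Nat using (ℕ; zero; suc; _+_; _*_; _⊓_)
open import Data.Fin using (Fin; zero; suc)
open import Data.Bool using (Bool; true; false)
open import Data.Vec using (Vec; []; _∷_)
open import Data.List using (List; []; _∷_)
open import Data.List.NonEmpty as L⁺ using (List⁺; _∷_; foldr₁; concatMap)
open import Data.Product using (_×_; _,_)

Mat : Set
Mat = Fin 3 → Fin 3 → ℕ

Row : Set
Row = Fin 3 → ℕ

mat : ℕ → ℕ → ℕ → ℕ → ℕ → ℕ → ℕ → ℕ → ℕ → Mat
mat a b c d e f g h i zero zero = a
mat a b c d e f g h i zero (suc zero) = b
mat a b c d e f g h i zero (suc (suc zero)) = c
mat a b c d e f g h i (suc zero) zero = d
mat a b c d e f g h i (suc zero) (suc zero) = e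
mat a b c d e f g h i (suc zero) (suc (suc zero)) = f
mat a b c d e f g h i (suc (suc zero)) zero = g
mat a b c d e f g h i (suc (suc zero)) (suc zero) = h
mat a b c d e f g h i (suc (suc zero)) (suc (suc zero)) = i

f0 f1 f2 : Fin 3
f0 = zero
f1 = suc zero
f2 = suc (suc zero)

_⊗_ : Mat → Mat → Mat
(A ⊗ B) i j = A i f0 * B f0 j + A i f1 * B f1 j + A i f2 * B f2 j

_·_ : Row → Mat → Row
(r · B) j = r f0 * B f0 j + r f1 * B f1 j + r f2 * B f2 j

A₀ A₁ : Mat
A₀ = mat 0 0 1  1 0 0  0 1 1
A₁ = mat 1 0 1  0 1 0  0 0 1

data S3 : Set where
  e p12 p13 p23 p123 p132 : S3

pm : S3 → Mat
pm e    = mat 1 0 0  0 1 0  0 0 1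
pm p12  = mat 0 1 0  1 0 0  0 0 1
pm p13  = mat 0 0 1  0 1 0  1 0 0
pm p23  = mat 1 0 0  0 0 1  0 1 0
pm p123 = mat 0 1 0  0 0 1  1 0 0
pm p132 = mat 0 0 1  1 0 0  0 1 0

Triplet : Set
Triplet = S3 × S3 × S3

F : Triplet → Bool → Mat
F (σ , τ₀ , τ₁) false = pm σ ⊗ (A₀ ⊗ pm τ₀)
F (σ , τ₀ , τ₁) true  = pm σ ⊗ (A₁ ⊗ pm τ₁)

ones : Row
ones _ = 1

triangleFrom : ∀ {n} → Triplet → Row → Vec Bool n → Row
triangleFrom t r [] = r
triangleFrom t r (i ∷ v) = triangleFrom t (r · F t i) v

triangle : ∀ {n} → Triplet → Vec Bool n → Row
triangle t v = triangleFrom t ones v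

words : (n : ℕ) → List⁺ (Vec Bool n)
words zero = [] ∷ []
words (suc n) = concatMap (λ v → (false ∷ v) ∷ (true ∷ v) ∷ []) (words n)

minRow : Row → ℕ
minRow r = r f0 ⊓ r f1 ⊓ r f2

minTerm : Triplet → ℕ → ℕ
minTerm t n = foldr₁ _⊓_ (L⁺.map (λ v → minRow (triangle t v)) (words n))

triplets : List Triplet
triplets =
  (e , p12 , p12) ∷ (e , p12 , p123) ∷ (e , p12 , p132) ∷ (e , p13 , p123) ∷
  (e , p13 , p132) ∷ (e , p23 , p12) ∷ (e , p23 , p123) ∷ (e , p23 , p132) ∷
  (e , p123 , p12) ∷ (e , p123 , p123) ∷ (e , p123 , p132) ∷ (e , e , e) ∷
  (e , e , p12) ∷ (e , e , p13) ∷ (e , e , p23) ∷ (e , p13 , e) ∷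
  (e , p13 , p13) ∷ (e , p13 , p23) ∷ (e , p132 , e) ∷ (e , p132 , p12) ∷
  (e , p132 , p13) ∷ (e , p132 , p23) ∷ (e , p12 , e) ∷ (e , p12 , p13) ∷
  (e , p12 , p23) ∷ (e , p13 , p12) ∷ (e , p23 , e) ∷ (e , p23 , p13) ∷
  (e , p23 , p23) ∷ (e , p123 , e) ∷ (e , p123 , p13) ∷ (e , p123 , p23) ∷ []

-- Every level of the tree has all entries ≥ 1, because no F_i has a zero
-- column and a row with positive entries times such a matrix stays positive.
-- The value 1 persists in every level, because for each coordinate k some F_i
-- has the k-th unit vector as a column j: then (r F_i)_j = r_k, so an entry
-- equal to 1 can be carried from (1,1,1) down to any depth.
module Submission where

open import Defs
open import Data.Nat using (ℕ; >-nonZero; z<s; zero; suc; _*_; _+_; _⊓_; _≤_; _<_; _<?_; _≟_)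
open import Data.Nat.Properties
  using (≤-refl; ≤-reflexive; ≤-trans; ≤-antisym; +-mono-≤; m≤n*m; m⊓n≤m; m⊓n≤n; ⊓-glb)
open import Data.Nat.Tactic.RingSolver using (solve-∀)
open import Data.Bool using (Bool; true; false; if_then_else_)
open import Data.Fin using (Fin; zero; suc)
import Data.Fin as Fin
open import Data.Fin.Properties using (all?; any?)
open import Data.Vec using (Vec; []; _∷_)
open import Data.List using ([]; _∷_)
open import Data.List.NonEmpty as L⁺ using (List⁺; _∷_; foldr₁; concatMap; toList)
open import Data.List.NonEmpty.Properties using (toList->>=)
open import Data.List.Relation.Unary.All as All using (All)
open import Data.List.Relation.Unary.Any using (here; there)
open import Data.List.Membership.Propositional using (_∈_; lose)
open import Data.List.Membership.Propositional.Properties using (∈-concatMap⁺)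
open import Function using (_∘_)
open import Data.Product using (_×_; _,_; ∃-syntax)
open import Data.Sum using (inj₁; inj₂; [_,_])
open import Relation.Nullary.Decidable using (Dec; does; map′; _×-dec_; _⊎-dec_; from-yes)
open import Relation.Binary.PropositionalEquality using (_≡_; refl; trans; subst)

Positive : Row → Set
Positive r = ∀ k → 0 < r k

colsum : Mat → Fin 3 → ℕ
colsum M j = M f0 j + M f1 j + M f2 j

NoZeroColumn : Mat → Set
NoZeroColumn M = ∀ j → 0 < colsum M j

basis : Fin 3 → Row
basis k l = if does (k Fin.≟ l) then 1 else 0

IsUnitColumn : Mat → Fin 3 → Fin 3 → Set
IsUnitColumn M j k = ∀ l → M l j ≡ basis k l

colsum-≤-· : ∀ {r} M j → Positive r → colsum M j ≤ (r · M) j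
colsum-≤-· {r} M j r>0 = +-mono-≤ (+-mono-≤ (entry f0) (entry f1)) (entry f2)
  where
  entry : ∀ k → M k j ≤ r k * M k j
  entry k = m≤n*m _ _ {{>-nonZero (r>0 k)}}

·-positive : ∀ {r} M → NoZeroColumn M → Positive r → Positive (r · M)
·-positive M M≠0 r>0 j = ≤-trans (M≠0 j) (colsum-≤-· M j r>0)

·-unitColumn : ∀ r M {j} k → IsUnitColumn M j k → (r · M) j ≡ r k
·-unitColumn r M k M[_,j]≡eₖ
  rewrite M[_,j]≡eₖ f0 | M[_,j]≡eₖ f1 | M[_,j]≡eₖ f2 = row·basis k
  where
  on-e₀ : ∀ a b c → a * 1 + b * 0 + c * 0 ≡ a
  on-e₀ = solve-∀
  on-e₁ : ∀ a b c → a * 0 + b * 1 + c * 0 ≡ b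
  on-e₁ = solve-∀
  on-e₂ : ∀ a b c → a * 0 + b * 0 + c * 1 ≡ c
  on-e₂ = solve-∀
  row·basis : ∀ k → r f0 * basis k f0 + r f1 * basis k f1 + r f2 * basis k f2 ≡ r k
  row·basis zero             = on-e₀ (r f0) (r f1) (r f2)
  row·basis (suc zero)       = on-e₁ (r f0) (r f1) (r f2)
  row·basis (suc (suc zero)) = on-e₂ (r f0) (r f1) (r f2)

NoZeroColumns : Triplet → Set
NoZeroColumns t = ∀ i → NoZeroColumn (F t i)

UnitColumns : Triplet → Set
UnitColumns t = ∀ k → ∃[ i ] ∃[ j ] IsUnitColumn (F t i) j k

triangleFrom-positive : ∀ t → NoZeroColumns t →
                        ∀ {n r} (v : Vec Bool n) → Positive r → Positive (triangleFrom t r v)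
triangleFrom-positive t F≠0 []      r>0 = r>0
triangleFrom-positive t F≠0 (i ∷ v) r>0 =
  triangleFrom-positive t F≠0 v (·-positive (F t i) (F≠0 i) r>0)

triangleFrom-preserves-entry : ∀ t → UnitColumns t →
                               ∀ n r k → ∃[ v ] ∃[ k′ ] triangleFrom {n} t r v k′ ≡ r k
triangleFrom-preserves-entry t eₖ∈F zero    r k = [] , k , refl
triangleFrom-preserves-entry t eₖ∈F (suc n) r k
  with i , j , unit ← eₖ∈F k
  with v , k′ , eq ← triangleFrom-preserves-entry t eₖ∈F n (r · F t i) j
  = i ∷ v , k′ , trans eq (·-unitColumn r (F t i) k unit)

minRow-≤ : ∀ r k → minRow r ≤ r k
minRow-≤ r zero             = ≤-trans (m⊓n≤m _ _) (m⊓n≤m _ _)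
minRow-≤ r (suc zero)       = ≤-trans (m⊓n≤m _ _) (m⊓n≤n _ _)
minRow-≤ r (suc (suc zero)) = m⊓n≤n _ _

minRow-positive : ∀ {r} → Positive r → 0 < minRow r
minRow-positive r>0 = ⊓-glb (⊓-glb (r>0 f0) (r>0 f1)) (r>0 f2)

foldr₁-⊓-map-≤ : ∀ {A : Set} (g : A → ℕ) xs {x} → x ∈ toList xs → foldr₁ _⊓_ (L⁺.map g xs) ≤ g x
foldr₁-⊓-map-≤ g (x ∷ xs) = go x xs
  where
  go : ∀ x xs {z} → z ∈ x ∷ xs → foldr₁ _⊓_ (L⁺.map g (x ∷ xs)) ≤ g z
  go x []       (here refl) = ≤-refl
  go x (y ∷ ys) (here refl) = m⊓n≤m _ _
  go x (y ∷ ys) (there z∈)  = ≤-trans (m⊓n≤n _ _) (go y ys z∈)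

foldr₁-⊓-map-glb : ∀ {A : Set} (g : A → ℕ) {m} xs → (∀ x → m ≤ g x) → m ≤ foldr₁ _⊓_ (L⁺.map g xs)
foldr₁-⊓-map-glb g {m} (x ∷ xs) m≤g = go x xs
  where
  go : ∀ x xs → m ≤ foldr₁ _⊓_ (L⁺.map g (x ∷ xs))
  go x []       = m≤g x
  go x (y ∷ ys) = ⊓-glb (m≤g x) (go y ys)

∈-toList-concatMap : ∀ {A B : Set} (f : A → List⁺ B) xs {x y} →
                     x ∈ toList xs → y ∈ toList (f x) → y ∈ toList (concatMap f xs)
∈-toList-concatMap f xs {y = y} x∈ y∈ =
  subst (y ∈_) (toList->>= f xs) (∈-concatMap⁺ (toList ∘ f) (lose x∈ y∈))

branches : ∀ {n} → Vec Bool n → List⁺ (Vec Bool (suc n))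
branches v = (false ∷ v) ∷ (true ∷ v) ∷ []

∈-words : ∀ {n} (v : Vec Bool n) → v ∈ toList (words n)
∈-words []          = here refl
∈-words (false ∷ v) = ∈-toList-concatMap branches (words _) (∈-words v) (here refl)
∈-words (true ∷ v)  = ∈-toList-concatMap branches (words _) (∈-words v) (there (here refl))

minTerm-≤ : ∀ t {n} (v : Vec Bool n) → minTerm t n ≤ minRow (triangle t v)
minTerm-≤ t v = foldr₁-⊓-map-≤ (minRow ∘ triangle t) (words _) (∈-words v)

minTerm-glb : ∀ t n {m} → (∀ v → m ≤ minRow (triangle t v)) → m ≤ minTerm t n
minTerm-glb t n = foldr₁-⊓-map-glb (minRow ∘ triangle t) (words n)

minTerm≡1 : ∀ t → NoZeroColumns t → UnitColumns t → ∀ n → minTerm t n ≡ 1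
minTerm≡1 t F≠0 eₖ∈F n = ≤-antisym upper lower
  where
  lower : 1 ≤ minTerm t n
  lower = minTerm-glb t n λ v → minRow-positive (triangleFrom-positive t F≠0 v λ _ → z<s)

  upper : minTerm t n ≤ 1
  upper =
    let v , k , v[k]≡1 = triangleFrom-preserves-entry t eₖ∈F n ones f0
    in ≤-trans (minTerm-≤ t v) (≤-trans (minRow-≤ (triangle t v) k) (≤-reflexive v[k]≡1))

∀-Bool? : ∀ {P : Bool → Set} → (∀ b → Dec (P b)) → Dec (∀ b → P b)
∀-Bool? P? = map′ (λ { (p , _) false → p ; (_ , p) true → p }) (λ p → p false , p true)
                  (P? false ×-dec P? true)

∃-Bool? : ∀ {P : Bool → Set} → (∀ b → Dec (P b)) → Dec (∃[ b ] P b)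
∃-Bool? P? = map′ [ (false ,_) , (true ,_) ] (λ { (false , p) → inj₁ p ; (true , p) → inj₂ p })
                  (P? false ⊎-dec P? true)

noZeroColumn? : ∀ M → Dec (NoZeroColumn M)
noZeroColumn? M = all? (λ j → 0 <? colsum M j)

isUnitColumn? : ∀ M j k → Dec (IsUnitColumn M j k)
isUnitColumn? M j k = all? (λ l → M l j ≟ basis k l)

criteria? : ∀ t → Dec (NoZeroColumns t × UnitColumns t)
criteria? t = ∀-Bool? (noZeroColumn? ∘ F t)
          ×-dec all? (λ k → ∃-Bool? λ i → any? λ j → isUnitColumn? (F t i) j k)

triplets-satisfy-criteria : All (λ t → NoZeroColumns t × UnitColumns t) triplets
triplets-satisfy-criteria = from-yes (All.all? criteria? triplets)

corollary19 : ∀ (t : Triplet) → t ∈ triplets → ∀ (n : ℕ) → minTerm t n ≡ 1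
corollary19 t t∈ = let F≠0 , eₖ∈F = All.lookup triplets-satisfy-criteria t∈ in minTerm≡1 t F≠0 eₖ∈F
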